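{- Let $\mathbb{G}$ be a finite reflexive digraph such that the identity is an isolated loop in $Hom(\mathbb{G},\mathbb{G})$. If $f:\mathbb{G}^p \rightarrow \mathbb{G}$ is a surjective, essentially unary polymorphism, then $f$ is an isolated loop in $Hom(\mathbb{G}^p,\mathbb{G})$.
   Context: All digraphs are finite and reflexive. For digraphs $\mathbb{G},\mathbb{H}$, $Hom(\mathbb{G},\mathbb{H})$ is the digraph whose vertices are the homomorphisms $\mathbb{G}\to\mathbb{H}$, with an arc $(f,g)$ iff $(f(x),g(y))$ is an arc of $\mathbb{H}$ whenever $(x,y)$ is an arc of $\mathbb{G}$. A vertex $h$ is an isolated loop if there is no arc $(h,g)$ or $(g,h)$ with $g\neq h$. $\mathbb{G}^p$ is the $p$-fold product digraph; a polymorphism $f:\mathbb{G}^p\to\mathbb{G}$ is a homomorphism, essentially unary if $f(x_1,\dots,x_p)=g(x_i)$ for some $i$ and some homomorphism $g:\mathbb{G}\to\mathbb{G}$. -}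

module Defs where

open import Data.Nat using (ℕ)
open import Data.Fin using (Fin)
open import Data.Bool using (Bool; T)
open import Data.Product using (Σ; ∃; _×_)
open import Relation.Binary.PropositionalEquality using (_≡_)

record Digraph : Set₁ where
  field
    V : Set
    E : V → V → Set
open Digraph public

FinDigraph : (n : ℕ) → (Fin n → Fin n → Bool) → Digraph
FinDigraph n adj = record { V = Fin n ; E = λ x y → T (adj x y) }

Reflexive : Digraph → Set
Reflexive G = ∀ x → E G x x

_^_ : Digraph → ℕ → Digraph
G ^ p = record { V = Fin p → V G ; E = λ x y → ∀ i → E G (x i) (y i) }

record Hom (G H : Digraph) : Set where
  constructor mkHom
  field
    fun : V G → V H
    pres : ∀ {x y} → E G x y → E H (fun x) (fun y)
open Hom public

idHom : (G : Digraph) → Hom G G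
idHom G = mkHom (λ x → x) (λ e → e)

HomArc : (G H : Digraph) → Hom G H → Hom G H → Set
HomArc G H f g = ∀ x y → E G x y → E H (fun f x) (fun g y)

_≈_ : {G H : Digraph} → Hom G H → Hom G H → Set
f ≈ g = ∀ x → fun f x ≡ fun g x

IsolatedLoop : (G H : Digraph) → Hom G H → Set
IsolatedLoop G H h = ∀ (g : Hom G H) → (HomArc G H h g → g ≈ h) × (HomArc G H g h → g ≈ h)

Surjective : {G H : Digraph} → Hom G H → Set
Surjective {G} {H} f = ∀ (y : V H) → ∃ λ (x : V G) → fun f x ≡ y

EssentiallyUnary : (G : Digraph) (p : ℕ) → Hom (G ^ p) G → Set
EssentiallyUnary G p f = Σ (Fin p) λ i → Σ (Hom G G) λ g → ∀ (x : Fin p → V G) → fun f x ≡ fun g (x i)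

-- The polymorphism is f(x) = g(x_i) with g : G → G.  Surjectivity of f makes g a
-- permutation of the finite vertex set, so some power of g is the identity and g has an
-- inverse homomorphism g⁻.  Given an arc between f and h in Hom(G^p, G) and a tuple y,
-- restrict both to the "line" through y in direction i (the homomorphism G → G^p varying
-- the i-th coordinate of y, which needs G reflexive) and post-compose with g⁻: this
-- yields an arc between the identity and an endomorphism K of G.  The identity being an
-- isolated loop forces K = id, and evaluating at y_i gives h(y) = g(y_i) = f(y).
module Submission where

open import Defs
open import Data.Nat using (ℕ)
open import Data.Fin using (Fin)
open import Data.Bool using (Bool)

open import Data.Nat using (zero; suc; _+_; _*_; _≤_; _!; pred)
open import Data.Nat.Properties using (+-suc; +-comm; n<1+n; m≤n+m; ≤-pred; ≤-trans; suc-pred; _!≢0; m≤n⇒∃[o]m+o≡n)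
open import Data.Nat.Divisibility using (divides; m∣m*n; m≤n⇒m!∣n!; ∣-trans)
open import Data.Fin as Fin using (toℕ)
open import Data.Fin.Properties using (pigeonhole; toℕ<n)
open import Data.Vec.Functional using (updateAt)
open import Data.Vec.Functional.Properties using (updateAt-updates; updateAt-minimal)
open import Data.Product using (∃; _×_; _,_; proj₁; proj₂)
open import Function using (const)
open import Relation.Nullary using (yes; no; contradiction)
open import Relation.Binary.Definitions using (DecidableEquality)
open import Relation.Binary.PropositionalEquality
import Function.Endo.Propositional as Endo
import Algebra.Properties.Monoid.Mult as MonoidMult

module Iteration {A : Set} where
  open Endo A using (^-homo) renaming (_^_ to _^ᵉ_)

  ^-suc′ : ∀ (f : A → A) k x → (f ^ᵉ suc k) x ≡ (f ^ᵉ k) (f x)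
  ^-suc′ f k x = cong-app (trans (cong (f ^ᵉ_) (+-comm 1 k)) (^-homo f k 1)) x

  ^-cancel : ∀ {g s : A → A} → (∀ x → g (s x) ≡ x) → ∀ k x → (g ^ᵉ k) ((s ^ᵉ k) x) ≡ x
  ^-cancel g∘s≗id zero    x = refl
  ^-cancel {g} {s} g∘s≗id (suc k) x = begin
    g ((g ^ᵉ k) (s ((s ^ᵉ k) x)))  ≡⟨ cong (λ z → g ((g ^ᵉ k) z)) (^-suc′ s k x) ⟩
    g ((g ^ᵉ k) ((s ^ᵉ k) (s x)))  ≡⟨ cong g (^-cancel g∘s≗id k (s x)) ⟩
    g (s x)                        ≡⟨ g∘s≗id x ⟩
    x                              ∎
    where open ≡-Reasoning

  ^-fixed : ∀ {f : A → A} {x} → f x ≡ x → ∀ q → (f ^ᵉ q) x ≡ x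
  ^-fixed fx≡x zero    = refl
  ^-fixed {f} fx≡x (suc q) = trans (cong f (^-fixed fx≡x q)) fx≡x

module FinitePermutation {n : ℕ} {g s : Fin n → Fin n} (g∘s≗id : ∀ x → g (s x) ≡ x) where
  open Endo (Fin n) using (^-homo; ∘-id-monoid) renaming (_^_ to _^ᵉ_)
  open MonoidMult ∘-id-monoid using (×-assocˡ)
  open Iteration

  -- Pigeonhole on x, s x, …, sⁿ x; the repetition is cancelled with g, which is a left
  -- inverse of every power of s.
  period : ∀ x → ∃ λ e → suc e ≤ n × (g ^ᵉ suc e) x ≡ x
  period x with pigeonhole (n<1+n n) (λ k → (s ^ᵉ toℕ k) x)
  ... | i , j , i<j , sⁱx≡sʲx with m≤n⇒∃[o]m+o≡n i<j
  ... | e , 1+i+e≡j = e , 1+e≤n , x≡c⇒periodic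
    where
      open ≡-Reasoning
      c : Fin n
      c = (s ^ᵉ suc e) x
      j≡i+1+e : toℕ j ≡ toℕ i + suc e
      j≡i+1+e = trans (sym 1+i+e≡j) (sym (+-suc (toℕ i) e))
      1+e≤n : suc e ≤ n
      1+e≤n = ≤-trans (m≤n+m (suc e) (toℕ i))
                (subst (_≤ n) j≡i+1+e (≤-pred (toℕ<n j)))
      x≡c : x ≡ c
      x≡c = begin
        x                                      ≡⟨ sym (^-cancel g∘s≗id (toℕ i) x) ⟩
        (g ^ᵉ toℕ i) ((s ^ᵉ toℕ i) x)          ≡⟨ cong (g ^ᵉ toℕ i) sⁱx≡sʲx ⟩
        (g ^ᵉ toℕ i) ((s ^ᵉ toℕ j) x)          ≡⟨ cong (λ k → (g ^ᵉ toℕ i) ((s ^ᵉ k) x)) j≡i+1+e ⟩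
        (g ^ᵉ toℕ i) ((s ^ᵉ (toℕ i + suc e)) x) ≡⟨ cong (g ^ᵉ toℕ i) (cong-app (^-homo s (toℕ i) (suc e)) x) ⟩
        (g ^ᵉ toℕ i) ((s ^ᵉ toℕ i) c)          ≡⟨ ^-cancel g∘s≗id (toℕ i) c ⟩
        c                                      ∎
      x≡c⇒periodic : (g ^ᵉ suc e) x ≡ x
      x≡c⇒periodic = trans (cong (g ^ᵉ suc e) x≡c) (^-cancel {g = g} {s} g∘s≗id (suc e) x)

  -- Every period is at most n, hence divides n!.
  ^n!≗id : ∀ x → (g ^ᵉ (n !)) x ≡ x
  ^n!≗id x with period x
  ... | e , 1+e≤n , periodic with ∣-trans (m∣m*n (e !)) (m≤n⇒m!∣n! 1+e≤n)
  ... | divides q n!≡q*[1+e] = begin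
    (g ^ᵉ (n !)) x          ≡⟨ cong (λ k → (g ^ᵉ k) x) n!≡q*[1+e] ⟩
    (g ^ᵉ (q * suc e)) x    ≡⟨ cong-app (sym (×-assocˡ g q (suc e))) x ⟩
    ((g ^ᵉ suc e) ^ᵉ q) x   ≡⟨ ^-fixed periodic q ⟩
    x                       ∎
    where open ≡-Reasoning

private
  variable
    A B C D : Digraph

infixr 25 _∘ʰ_
_∘ʰ_ : Hom C D → Hom B C → Hom B D
t ∘ʰ f = mkHom (λ x → fun t (fun f x)) (λ e → pres t (pres f e))

HomArc-resp-≈ : ∀ {f f′ h h′ : Hom A B} → HomArc A B f h → f ≈ f′ → h ≈ h′ → HomArc A B f′ h′
HomArc-resp-≈ {B = B} arc f≈f′ h≈h′ x y e = subst₂ (E B) (f≈f′ x) (h≈h′ y) (arc x y e)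

HomArc-∘ : ∀ {f h : Hom B C} (s : Hom C D) → HomArc B C f h → (t : Hom A B)
  → HomArc A D (s ∘ʰ f ∘ʰ t) (s ∘ʰ h ∘ʰ t)
HomArc-∘ s arc t x y e = pres s (arc (fun t x) (fun t y) (pres t e))

module _ {G : Digraph} where
  open Endo (V G) using () renaming (_^_ to _^ᵉ_)
  open Iteration

  record Invertible (g : Hom G G) : Set where
    field
      inverse  : Hom G G
      inverseˡ : ∀ x → fun inverse (fun g x) ≡ x
      inverseʳ : ∀ x → fun g (fun inverse x) ≡ x

  infixr 8 _^ʰ_
  _^ʰ_ : Hom G G → ℕ → Hom G G
  g ^ʰ m = mkHom (fun g ^ᵉ m) (pres-^ m)
    where
      pres-^ : ∀ m {x y} → E G x y → E G ((fun g ^ᵉ m) x) ((fun g ^ᵉ m) y)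
      pres-^ zero    e = e
      pres-^ (suc m) e = pres g (pres-^ m e)

  periodic⇒invertible : (g : Hom G G) (m : ℕ) → (∀ x → (fun g ^ᵉ suc m) x ≡ x) → Invertible g
  periodic⇒invertible g m periodic = record
    { inverse  = g ^ʰ m
    ; inverseˡ = λ x → trans (sym (^-suc′ (fun g) m x)) (periodic x)
    ; inverseʳ = periodic
    }

module _ {n : ℕ} {adj : Fin n → Fin n → Bool} where
  open Endo (Fin n) using () renaming (_^_ to _^ᵉ_)

  hasSection⇒invertible : (g : Hom (FinDigraph n adj) (FinDigraph n adj)) (s : Fin n → Fin n)
    → (∀ x → fun g (s x) ≡ x) → Invertible g
  hasSection⇒invertible g s g∘s≗id = periodic⇒invertible g (pred (n !)) λ x →
    trans (cong (λ k → (fun g ^ᵉ k) x) (suc-pred (n !) {{n !≢0}})) (FinitePermutation.^n!≗id g∘s≗id x)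

module Line {G : Digraph} (_≟_ : DecidableEquality (V G)) {p : ℕ} (y : Fin p → V G) (i : Fin p) where

  -- The case split returns y itself at u = y i: a merely pointwise equal tuple would not
  -- let us conclude anything about h(y) without function extensionality.
  through : V G → Fin p → V G
  through u with u ≟ y i
  ... | yes _ = y
  ... | no  _ = updateAt y i (const u)

  through-self : through (y i) ≡ y
  through-self with y i ≟ y i
  ... | yes _    = refl
  ... | no  yᵢ≢yᵢ = contradiction refl yᵢ≢yᵢ

  through-at : ∀ u → through u i ≡ u
  through-at u with u ≟ y i
  ... | yes u≡yᵢ = sym u≡yᵢ
  ... | no  _    = updateAt-updates i y

  through-off : ∀ u {j} → j ≢ i → through u j ≡ y j
  through-off u {j} j≢i with u ≟ y i
  ... | yes _ = refl
  ... | no  _ = updateAt-minimal j i y j≢i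

  lineHom : Reflexive G → Hom G (G ^ p)
  lineHom refl-G = mkHom through pres-through
    where
      pres-through : ∀ {u v} → E G u v → E (G ^ p) (through u) (through v)
      pres-through {u} {v} e j with j Fin.≟ i
      ... | yes refl = subst₂ (E G) (sym (through-at u)) (sym (through-at v)) e
      ... | no  j≢i  = subst₂ (E G) (sym (through-off u j≢i)) (sym (through-off v j≢i)) (refl-G (y j))

module _ {G : Digraph} (_≟_ : DecidableEquality (V G)) (refl-G : Reflexive G)
         (id-isolated : IsolatedLoop G G (idHom G)) {p : ℕ}
         (f : Hom (G ^ p) G) (i : Fin p) (g : Hom G G) (g-inv : Invertible g)
         (f≗g∘πᵢ : ∀ x → fun f x ≡ fun g (x i)) where
  open Invertible g-inv renaming (inverse to g⁻)

  invertible-projection-isolated : IsolatedLoop (G ^ p) G f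
  invertible-projection-isolated h =
      (λ arc y → h≡f-at y (proj₁ (id-isolated (K y)) (f→h⇒id→K y arc)))
    , (λ arc y → h≡f-at y (proj₂ (id-isolated (K y)) (h→f⇒K→id y arc)))
    where
      module _ (y : Fin p → V G) where
        open Line _≟_ y i

        ℓ : Hom G (G ^ p)
        ℓ = lineHom refl-G

        K : Hom G G
        K = g⁻ ∘ʰ h ∘ʰ ℓ

        F : Hom G G
        F = g⁻ ∘ʰ f ∘ʰ ℓ

        F≈id : F ≈ idHom G
        F≈id u = trans (cong (fun g⁻) (trans (f≗g∘πᵢ (through u)) (cong (fun g) (through-at u))))
                       (inverseˡ u)

        f→h⇒id→K : HomArc (G ^ p) G f h → HomArc G G (idHom G) K
        f→h⇒id→K arc = HomArc-resp-≈ {f = F} {idHom G} {K} {K}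
          (HomArc-∘ {f = f} {h = h} g⁻ arc ℓ) F≈id (λ _ → refl)

        h→f⇒K→id : HomArc (G ^ p) G h f → HomArc G G K (idHom G)
        h→f⇒K→id arc = HomArc-resp-≈ {f = K} {K} {F} {idHom G}
          (HomArc-∘ {f = h} {h = f} g⁻ arc ℓ) (λ _ → refl) F≈id

        h≡f-at : K ≈ idHom G → fun h y ≡ fun f y
        h≡f-at K≈id = begin
          fun h y                ≡⟨ cong (fun h) (sym through-self) ⟩
          fun h (through (y i))  ≡⟨ sym (inverseʳ _) ⟩
          fun g (fun K (y i))    ≡⟨ cong (fun g) (K≈id (y i)) ⟩
          fun g (y i)            ≡⟨ sym (f≗g∘πᵢ y) ⟩
          fun f y                ∎
          where open ≡-Reasoning

lemma3p1 : (n : ℕ) (adj : Fin n → Fin n → Bool) (p : ℕ)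
    → Reflexive (FinDigraph n adj)
    → IsolatedLoop (FinDigraph n adj) (FinDigraph n adj) (idHom (FinDigraph n adj))
    → (f : Hom (FinDigraph n adj ^ p) (FinDigraph n adj))
    → Surjective f
    → EssentiallyUnary (FinDigraph n adj) p f
    → IsolatedLoop (FinDigraph n adj ^ p) (FinDigraph n adj) f
lemma3p1 n adj p refl-G id-isolated f f-surj (i , g , f≗g∘πᵢ) =
  invertible-projection-isolated Fin._≟_ refl-G id-isolated f i g
    (hasSection⇒invertible g section g∘section≗id) f≗g∘πᵢ
  where
    section : Fin n → Fin n
    section x = proj₁ (f-surj x) i
    g∘section≗id : ∀ x → fun g (section x) ≡ x
    g∘section≗id x = trans (sym (f≗g∘πᵢ (proj₁ (f-surj x)))) (proj₂ (f-surj x))
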